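{- We have that $$\sum_{\pi\in\mathcal S_n(321)}\mathbf{x}_{\mathrm{Des}(\pi)}=\sum_T \left(C_{n-|T|}\prod_{j\in T}(x_j-1)\right),$$ where $T$ ranges over all subsets of $[n-1]$ with no two consecutive elements.
   Context: $\mathcal S_n(321)$ is the set of $321$-avoiding permutations of $\{1,\dots,n\}$; $\mathrm{Des}(\pi)=\{i:\pi(i)>\pi(i+1)\}$; for a set $S$ of positive integers, $\mathbf{x}_S=\prod_{j\in S}x_j$; $C_m=\frac{1}{m+1}\binom{2m}{m}$ is the $m$-th Catalan number. -}

module Defs where

open import Data.Bool using (Bool; true; false; not; _∧_; _∨_; if_then_else_)
open import Data.Nat using (ℕ; zero; suc; _∸_; _<ᵇ_; _≡ᵇ_) renaming (_+_ to _+ℕ_; _*_ to _*ℕ_)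
open import Data.Nat.DivMod using (_/_)
open import Data.Nat.Combinatorics using (_C_)
open import Data.Integer using (ℤ; +_; _+_; _*_; _-_)
open import Data.List using (List; []; _∷_; [_]; map; concatMap; filter; length; upTo; foldr)
open import Data.Bool.ListAction using (any; all)
open import Relation.Nullary.Decidable using (Dec)
open import Data.Bool.Properties using (T?)

-- Catalan number C_m = binom(2m, m) / (m + 1)  (exact division)
catalan : ℕ → ℕ
catalan m = ((2 *ℕ m) C m) / suc m

-- Permutations of a word are represented as lists (one-line notation).
-- All ways of inserting a into a list.
insertions : ℕ → List ℕ → List (List ℕ)
insertions a [] = [ a ∷ [] ]
insertions a (b ∷ bs) = (a ∷ b ∷ bs) ∷ map (b ∷_) (insertions a bs)

perms : List ℕ → List (List ℕ)
perms [] = [ [] ]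
perms (a ∷ as) = concatMap (insertions a) (perms as)

range1 : ℕ → List ℕ
range1 n = map suc (upTo n)

Sn : ℕ → List (List ℕ)
Sn n = perms (range1 n)

has21below : ℕ → List ℕ → Bool
has21below a [] = false
has21below a (b ∷ l) = ((b <ᵇ a) ∧ any (_<ᵇ b) l) ∨ has21below a l

contains321 : List ℕ → Bool
contains321 [] = false
contains321 (a ∷ l) = has21below a l ∨ contains321 l

Sn321 : ℕ → List (List ℕ)
Sn321 n = filter (λ π → T? (not (contains321 π))) (Sn n)

sumℤ : List ℤ → ℤ
sumℤ = foldr _+_ (+ 0)

prodℤ : List ℤ → ℤ
prodℤ = foldr _*_ (+ 1)

-- x_{Des(π)} for π written in one-line notation starting at position i:
-- product of x_i over positions i with π(i) > π(i+1)
xDesFrom : (ℕ → ℤ) → ℕ → List ℕ → ℤ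
xDesFrom x i [] = + 1
xDesFrom x i (a ∷ []) = + 1
xDesFrom x i (a ∷ b ∷ l) = (if b <ᵇ a then x i else + 1) * xDesFrom x (suc i) (b ∷ l)

xDes : (ℕ → ℤ) → List ℕ → ℤ
xDes x π = xDesFrom x 1 π

subsets : List ℕ → List (List ℕ)
subsets [] = [ [] ]
subsets (a ∷ as) = subsets as Data.List.++ map (a ∷_) (subsets as)

elemℕ : ℕ → List ℕ → Bool
elemℕ j = any (j ≡ᵇ_)

noConsec : List ℕ → Bool
noConsec T = all (λ j → not (elemℕ (suc j) T)) T

sparseSubsets : ℕ → List (List ℕ)
sparseSubsets n = filter (λ T → T? (noConsec T)) (subsets (range1 (n ∸ 1)))

lhs : ℕ → (ℕ → ℤ) → ℤ
lhs n x = sumℤ (map (xDes x) (Sn321 n))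

rhs : ℕ → (ℕ → ℤ) → ℤ
rhs n x = sumℤ (map (λ T → (+ catalan (n ∸ length T)) * prodℤ (map (λ j → x j - + 1) T)) (sparseSubsets n))

module Submission where

-- Refine the left-hand side by the position of the first descent: for a head
-- weight t and descent variables z put
--   weight t z π = t (first descent of π, or |π| if none) · Π_{later descents i} z_i ,
--   Φ m t z      = Σ_{π ∈ S_m(321)} weight t z π ,
-- which is linear in t.  Removing the letter 1 from π ∈ S_{m+1}(321) gives the
-- insertion recursion  Φ (m+1) t z = Φ m (insertHead t z') z'  (z' = z shifted,
-- provided z_{m+1} = 1) for an explicit linear operator insertHead.  On the basis
-- t = δ_a this recursion is solved in closed form by sparse-subset polynomials
-- whose coefficients are ballot numbers (Φ-indicator, Φ-tail).  The right-hand side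
-- is a sparse-subset polynomial as well (split on 1 ∈ T), and the ballot numbers
-- that occur are Catalan numbers (Pascal rule plus absorption).

open import Defs
open import Data.Bool using (Bool; true; false; not; _∧_; _∨_; if_then_else_)
open import Data.Bool.Properties using (T?; ∨-zeroʳ; ∨-identityʳ)
open import Data.Bool.ListAction using (any; all)
open import Data.Nat using (ℕ; zero; suc; pred; _∸_; _<ᵇ_; _≡ᵇ_; s≤s; z≤n)
  renaming (_+_ to _+ℕ_; _*_ to _*ℕ_; _≤_ to _≤ℕ_; _<_ to _<ℕ_)
import Data.Nat.Properties as ℕP
open import Data.Nat.Combinatorics
  using (_C_; nCn≡1; nCk+nC[k+1]≡[n+1]C[k+1]; nCk≡nC[n∸k]; k>n⇒nCk≡0; nC1≡n)
open import Data.Nat.DivMod using (_/_; m*n/n≡m)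
import Data.Nat.Tactic.RingSolver as ℕ-Solver
open import Data.Integer using (ℤ; +_; _+_; _*_; _-_)
import Data.Integer.Properties as ℤP
open import Data.Integer.Tactic.RingSolver using (solve-∀)
open import Data.List using (List; []; _∷_; map; concatMap; concat; filter; length; upTo; _++_)
open import Data.List.Properties using (map-++; map-cong; map-∘; concat-map; map-applyUpTo; length-map; length-upTo)
open import Data.List.Relation.Unary.All as All using (All)
import Data.List.Relation.Unary.All.Properties as AllP
open import Data.Product using (_×_; _,_; proj₁; proj₂)
open import Data.Sum using (inj₁; inj₂)
open import Function using (_∘_; id)
open import Relation.Binary.PropositionalEquality

sh : (ℕ → ℤ) → ℕ → ℤ
sh f a = f (suc a)

sum-++ : (xs ys : List ℤ) → sumℤ (xs ++ ys) ≡ sumℤ xs + sumℤ ys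
sum-++ []       ys = sym (ℤP.+-identityˡ _)
sum-++ (x ∷ xs) ys = trans (cong (_+_ x) (sum-++ xs ys)) (sym (ℤP.+-assoc x _ _))

sum-cong : ∀ {A : Set} {f g : A → ℤ} → (∀ x → f x ≡ g x) → ∀ xs → sumℤ (map f xs) ≡ sumℤ (map g xs)
sum-cong e xs = cong sumℤ (map-cong e xs)

sum-congᴬ : ∀ {A : Set} {f g : A → ℤ} {xs} → All (λ x → f x ≡ g x) xs → sumℤ (map f xs) ≡ sumℤ (map g xs)
sum-congᴬ All.[]       = refl
sum-congᴬ (p All.∷ ps) = cong₂ _+_ p (sum-congᴬ ps)

sum-map-∘ : ∀ {A B : Set} (f : B → ℤ) (g : A → B) xs → sumℤ (map f (map g xs)) ≡ sumℤ (map (f ∘ g) xs)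
sum-map-∘ f g xs = cong sumℤ (sym (map-∘ xs))

sum-concatMap : ∀ {A B : Set} (f : B → ℤ) (g : A → List B) xs →
  sumℤ (map f (concatMap g xs)) ≡ sumℤ (map (λ x → sumℤ (map f (g x))) xs)
sum-concatMap f g []       = refl
sum-concatMap f g (x ∷ xs) =
  trans (cong sumℤ (map-++ f (g x) (concatMap g xs)))
        (trans (sum-++ (map f (g x)) _) (cong (_+_ (sumℤ (map f (g x)))) (sum-concatMap f g xs)))

sum-filter : ∀ {A : Set} (p : A → Bool) (f : A → ℤ) xs →
  sumℤ (map f (filter (λ x → T? (p x)) xs)) ≡ sumℤ (map (λ x → if p x then f x else + 0) xs)
sum-filter p f [] = refl
sum-filter p f (x ∷ xs) with p x
... | true  = cong (_+_ (f x)) (sum-filter p f xs)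
... | false = trans (sum-filter p f xs) (sym (ℤP.+-identityˡ _))

sum-zero : ∀ {A : Set} (xs : List A) → sumℤ (map (λ _ → + 0) xs) ≡ + 0
sum-zero []       = refl
sum-zero (x ∷ xs) = trans (ℤP.+-identityˡ _) (sum-zero xs)

sum-+ : ∀ {A : Set} (f g : A → ℤ) xs → sumℤ (map (λ x → f x + g x) xs) ≡ sumℤ (map f xs) + sumℤ (map g xs)
sum-+ f g []       = refl
sum-+ f g (x ∷ xs) = trans (cong (_+_ (f x + g x)) (sum-+ f g xs)) (interchange (f x) (g x) _ _)
  where
  interchange : ∀ (a b c d : ℤ) → a + b + (c + d) ≡ a + c + (b + d)
  interchange = solve-∀

sum-scale : ∀ {A : Set} (k : ℤ) (f : A → ℤ) xs → sumℤ (map (λ x → k * f x) xs) ≡ k * sumℤ (map f xs)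
sum-scale k f []       = sym (ℤP.*-zeroʳ k)
sum-scale k f (x ∷ xs) = trans (cong (_+_ (k * f x)) (sum-scale k f xs)) (sym (ℤP.*-distribˡ-+ k (f x) _))

insertions-map : (f : ℕ → ℕ) (a : ℕ) (l : List ℕ) → insertions (f a) (map f l) ≡ map (map f) (insertions a l)
insertions-map f a []      = refl
insertions-map f a (b ∷ l) = cong ((f a ∷ f b ∷ map f l) ∷_)
  (trans (cong (map (f b ∷_)) (insertions-map f a l)) (trans (sym (map-∘ (insertions a l))) (map-∘ (insertions a l))))

perms-map : (f : ℕ → ℕ) (l : List ℕ) → perms (map f l) ≡ map (map f) (perms l)
perms-map f []      = refl
perms-map f (a ∷ l) = begin
    concat (map (insertions (f a)) (perms (map f l)))
  ≡⟨ cong (λ P → concat (map (insertions (f a)) P)) (perms-map f l) ⟩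
    concat (map (insertions (f a)) (map (map f) (perms l)))
  ≡⟨ cong concat (sym (map-∘ (perms l))) ⟩
    concat (map (insertions (f a) ∘ map f) (perms l))
  ≡⟨ cong concat (map-cong (insertions-map f a) (perms l)) ⟩
    concat (map (map (map f) ∘ insertions a) (perms l))
  ≡⟨ cong concat (map-∘ (perms l)) ⟩
    concat (map (map (map f)) (map (insertions a) (perms l)))
  ≡⟨ concat-map (map (insertions a) (perms l)) ⟩
    map (map f) (concat (map (insertions a) (perms l)))
  ∎
  where open ≡-Reasoning

range1-suc : ∀ m → range1 (suc m) ≡ 1 ∷ map suc (range1 m)
range1-suc m = cong (1 ∷_) (trans (map-applyUpTo suc suc m)
  (sym (trans (cong (map suc) (map-applyUpTo id suc m)) (map-applyUpTo suc suc m))))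

length-insertions : (a : ℕ) (l : List ℕ) → All (λ π → length π ≡ suc (length l)) (insertions a l)
length-insertions a []      = refl All.∷ All.[]
length-insertions a (b ∷ l) = refl All.∷ AllP.map⁺ (All.map (cong suc) (length-insertions a l))

length-perms : (l : List ℕ) → All (λ π → length π ≡ length l) (perms l)
length-perms []      = refl All.∷ All.[]
length-perms (a ∷ l) = AllP.concat⁺ (AllP.map⁺ (All.map
  (λ {σ} e → All.map (λ e' → trans e' (cong suc e)) (length-insertions a σ)) (length-perms l)))

xDesFrom-map-suc : ∀ z i l → xDesFrom z i (map suc l) ≡ xDesFrom z i l
xDesFrom-map-suc z i []          = refl
xDesFrom-map-suc z i (a ∷ [])    = refl
xDesFrom-map-suc z i (a ∷ b ∷ l) = cong ((if b <ᵇ a then z i else + 1) *_) (xDesFrom-map-suc z (suc i) (b ∷ l))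

anyBelow-map-suc : ∀ c l → any (_<ᵇ suc c) (map suc l) ≡ any (_<ᵇ c) l
anyBelow-map-suc c []      = refl
anyBelow-map-suc c (x ∷ l) = cong ((x <ᵇ c) ∨_) (anyBelow-map-suc c l)

has21below-map-suc : ∀ a l → has21below (suc a) (map suc l) ≡ has21below a l
has21below-map-suc a []      = refl
has21below-map-suc a (b ∷ l) = cong₂ (λ u v → ((b <ᵇ a) ∧ u) ∨ v) (anyBelow-map-suc b l) (has21below-map-suc a l)

contains321-map-suc : ∀ l → contains321 (map suc l) ≡ contains321 l
contains321-map-suc []      = refl
contains321-map-suc (a ∷ l) = cong₂ _∨_ (has21below-map-suc a l) (contains321-map-suc l)

xDesFrom-shift : ∀ z i l → xDesFrom z (suc i) l ≡ xDesFrom (sh z) i l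
xDesFrom-shift z i []          = refl
xDesFrom-shift z i (a ∷ [])    = refl
xDesFrom-shift z i (a ∷ b ∷ l) = cong ((if b <ᵇ a then z (suc i) else + 1) *_) (xDesFrom-shift z (suc i) (b ∷ l))

-- The first-descent weight:
-- weight t z π = t d · Π { z_i : i ∈ Des π, i > d }, where d is the first
-- descent of π (d = |π| if π is increasing).  The head weight t enters linearly.

mutual
  weight : (ℕ → ℤ) → (ℕ → ℤ) → List ℕ → ℤ
  weight t z []          = t 0
  weight t z (a ∷ [])    = t 1
  weight t z (a ∷ b ∷ l) = weightStep (b <ᵇ a) t z (b ∷ l)

  weightStep : Bool → (ℕ → ℤ) → (ℕ → ℤ) → List ℕ → ℤ
  weightStep true  t z l = t 1 * xDesFrom z 2 l
  weightStep false t z l = weight (sh t) (sh z) l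

weight-map-suc : ∀ t z l → weight t z (map suc l) ≡ weight t z l
weight-map-suc t z []          = refl
weight-map-suc t z (a ∷ [])    = refl
weight-map-suc t z (a ∷ b ∷ l) = step (b <ᵇ a) (b ∷ l)
  where
  step : ∀ c l → weightStep c t z (map suc l) ≡ weightStep c t z l
  step true  l = cong (t 1 *_) (xDesFrom-map-suc z 2 l)
  step false l = weight-map-suc (sh t) (sh z) l

weight-cong : ∀ {t t'} z l → (∀ a → t a ≡ t' a) → weight t z l ≡ weight t' z l
weight-cong z []          e = e 0
weight-cong z (a ∷ [])    e = e 1
weight-cong {t} {t'} z (a ∷ b ∷ l) e = step (b <ᵇ a) (b ∷ l)
  where
  step : ∀ c l → weightStep c t z l ≡ weightStep c t' z l
  step true  l = cong (_* xDesFrom z 2 l) (e 1)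
  step false l = weight-cong (sh z) l (λ a → e (suc a))

-- On a nonempty word the head weight is never evaluated at 0.
weight-cong⁺ : ∀ {t t'} z a l → (∀ i → t (suc i) ≡ t' (suc i)) → weight t z (a ∷ l) ≡ weight t' z (a ∷ l)
weight-cong⁺ z a []          e = e 0
weight-cong⁺ {t} {t'} z a (b ∷ l) e = step (b <ᵇ a)
  where
  step : ∀ c → weightStep c t z (b ∷ l) ≡ weightStep c t' z (b ∷ l)
  step true  = cong (_* xDesFrom z 2 (b ∷ l)) (e 0)
  step false = weight-cong⁺ (sh z) b l (λ i → e (suc i))

weight-+ : ∀ f g z l → weight (λ a → f a + g a) z l ≡ weight f z l + weight g z l
weight-+ f g z []          = refl
weight-+ f g z (a ∷ [])    = refl
weight-+ f g z (a ∷ b ∷ l) = step (b <ᵇ a) (b ∷ l)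
  where
  step : ∀ c l → weightStep c (λ a → f a + g a) z l ≡ weightStep c f z l + weightStep c g z l
  step true  l = ℤP.*-distribʳ-+ (xDesFrom z 2 l) (f 1) (g 1)
  step false l = weight-+ (sh f) (sh g) (sh z) l

weight-scaleʳ : ∀ f k z l → weight (λ a → f a * k) z l ≡ weight f z l * k
weight-scaleʳ f k z []          = refl
weight-scaleʳ f k z (a ∷ [])    = refl
weight-scaleʳ f k z (a ∷ b ∷ l) = step (b <ᵇ a) (b ∷ l)
  where
  swap : ∀ (a k x : ℤ) → a * k * x ≡ a * x * k
  swap = solve-∀
  step : ∀ c l → weightStep c (λ a → f a * k) z l ≡ weightStep c f z l * k
  step true  l = swap (f 1) k _
  step false l = weight-scaleʳ (sh f) k (sh z) l

weight-scaleˡ : ∀ k f z l → weight (λ a → k * f a) z l ≡ k * weight f z l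
weight-scaleˡ k f z l =
  trans (weight-cong z l (λ a → ℤP.*-comm k (f a))) (trans (weight-scaleʳ f k z l) (ℤP.*-comm _ k))

weight-zero : ∀ z l → weight (λ _ → + 0) z l ≡ + 0
weight-zero z []          = refl
weight-zero z (a ∷ [])    = refl
weight-zero z (a ∷ b ∷ l) = step (b <ᵇ a) (b ∷ l)
  where
  step : ∀ c l → weightStep c (λ _ → + 0) z l ≡ + 0
  step true  l = ℤP.*-zeroˡ (xDesFrom z 2 l)
  step false l = weight-zero (sh z) l

-- x_{Des π} is the weight whose head weight agrees with z at positive positions,
-- provided z equals 1 at the last position |π| (which is never a descent).
xDes≡weight : ∀ a t z l → (∀ i → t (suc i) ≡ z (suc i)) → z (length (a ∷ l)) ≡ + 1 →
              xDesFrom z 1 (a ∷ l) ≡ weight t z (a ∷ l)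
xDes≡weight a t z []      e h = sym (trans (e 0) h)
xDes≡weight a t z (b ∷ l) e h = step (b <ᵇ a) tail
  where
  tail : + 1 * xDesFrom z 2 (b ∷ l) ≡ weight (sh t) (sh z) (b ∷ l)
  tail = trans (ℤP.*-identityˡ _) (trans (xDesFrom-shift z 1 (b ∷ l))
               (xDes≡weight b (sh t) (sh z) l (λ i → e (suc i)) h))
  step : ∀ c → + 1 * xDesFrom z 2 (b ∷ l) ≡ weight (sh t) (sh z) (b ∷ l) →
         (if c then z 1 else + 1) * xDesFrom z 2 (b ∷ l) ≡ weightStep c t z (b ∷ l)
  step true  _ = cong (_* xDesFrom z 2 (b ∷ l)) (sym (e 0))
  step false q = q

xDes-local : ∀ x y l → (∀ a → suc (suc a) ≤ℕ length l → x (suc a) ≡ y (suc a)) → xDesFrom x 1 l ≡ xDesFrom y 1 l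
xDes-local x y []          e = refl
xDes-local x y (a ∷ [])    e = refl
xDes-local x y (a ∷ b ∷ l) e =
  cong₂ _*_ (cong (λ v → if b <ᵇ a then v else + 1) (e 0 (s≤s (s≤s z≤n))))
            (trans (xDesFrom-shift x 1 (b ∷ l))
            (trans (xDes-local (sh x) (sh y) (b ∷ l) (λ i le → e (suc i) (s≤s le)))
                   (sym (xDesFrom-shift y 1 (b ∷ l)))))

∨-false : ∀ a b → a ∨ b ≡ false → (a ≡ false) × (b ≡ false)
∨-false false b e = refl , e

false≢true : ∀ {A : Set} → false ≡ true → A
false≢true ()

has21below-1 : ∀ l → has21below 1 (map suc l) ≡ false
has21below-1 []      = refl
has21below-1 (x ∷ l) = has21below-1 l

anyBelow-1 : ∀ l → any (_<ᵇ 1) (map suc l) ≡ false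
anyBelow-1 []      = refl
anyBelow-1 (x ∷ l) = anyBelow-1 l

anyBelow-insert1 : ∀ c l → All (λ π → any (_<ᵇ suc (suc c)) π ≡ true) (insertions 1 l)
anyBelow-insert1 c []      = refl All.∷ All.[]
anyBelow-insert1 c (d ∷ l) = refl All.∷ AllP.map⁺
  (All.map (λ e → trans (cong ((d <ᵇ suc (suc c)) ∨_) e) (∨-zeroʳ _)) (anyBelow-insert1 c l))

<ᵇ-trans : ∀ d b c → (d <ᵇ b) ≡ true → (c <ᵇ b) ≡ false → (d <ᵇ c) ≡ true
<ᵇ-trans zero    (suc b) zero    p ()
<ᵇ-trans zero    (suc b) (suc c) p q = refl
<ᵇ-trans (suc d) (suc b) zero    p ()
<ᵇ-trans (suc d) (suc b) (suc c) p q = <ᵇ-trans d b c p q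

has21below-mono : ∀ b c l → (c <ᵇ b) ≡ false → has21below c l ≡ false → has21below b l ≡ false
has21below-mono b c []      q h = refl
has21below-mono b c (d ∷ l) q h = step (d <ᵇ b) refl
  where
  A = any (_<ᵇ d) l
  rest = has21below-mono b c l q (proj₂ (∨-false _ _ h))
  step : ∀ v → (d <ᵇ b) ≡ v → ((d <ᵇ b) ∧ A) ∨ has21below b l ≡ false
  step true  e = trans (cong (λ w → (w ∧ A) ∨ has21below b l) e)
    (trans (cong (_∨ has21below b l) (trans (sym (cong (_∧ A) (<ᵇ-trans d b c e q))) (proj₁ (∨-false _ _ h)))) rest)
  step false e = trans (cong (λ w → (w ∧ A) ∨ has21below b l) e) rest

any-insertions : ∀ p a l → any p l ≡ true → All (λ π → any p π ≡ true) (insertions a l)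
any-insertions p a (d ∷ l) h = trans (cong (p a ∨_) h) (∨-zeroʳ (p a)) All.∷ AllP.map⁺ (step (p d) refl)
  where
  step : ∀ v → p d ≡ v → All (λ π → any p (d ∷ π) ≡ true) (insertions a l)
  step true  e = All.universal (λ π → cong (_∨ any p π) e) _
  step false e = All.map (λ e' → cong₂ _∨_ e e') (any-insertions p a l (trans (sym (cong (_∨ any p l) e)) h))

has21below-insertions : ∀ b a l → has21below b l ≡ true → All (λ π → has21below b π ≡ true) (insertions a l)
has21below-insertions b a (d ∷ l) h =
  trans (cong (((a <ᵇ b) ∧ any (_<ᵇ a) (d ∷ l)) ∨_) h) (∨-zeroʳ _) All.∷ AllP.map⁺ (step (has21below b l) refl)
  where
  A = any (_<ᵇ d) l
  step : ∀ v → has21below b l ≡ v → All (λ π → has21below b (d ∷ π) ≡ true) (insertions a l)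
  step true  e = All.map (λ {π} e' → trans (cong (((d <ᵇ b) ∧ any (_<ᵇ d) π) ∨_) e') (∨-zeroʳ _)) (has21below-insertions b a l e)
  step false e = headStep (d <ᵇ b) refl
    where
    headPattern : (d <ᵇ b) ∧ A ≡ true
    headPattern = trans (sym (∨-identityʳ _)) (trans (cong (((d <ᵇ b) ∧ A) ∨_) (sym e)) h)
    headStep : ∀ w → (d <ᵇ b) ≡ w → All (λ π → has21below b (d ∷ π) ≡ true) (insertions a l)
    headStep true  e2 = All.map (λ {π} e' → trans (cong (λ w → (w ∧ any (_<ᵇ d) π) ∨ has21below b π) e2) (cong (_∨ has21below b π) e'))
                                (any-insertions (_<ᵇ d) a l (trans (sym (cong (_∧ A) e2)) headPattern))
    headStep false e2 = false≢true (trans (sym (cong (_∧ A) e2)) headPattern)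

contains321-insertions : ∀ a l → contains321 l ≡ true → All (λ π → contains321 π ≡ true) (insertions a l)
contains321-insertions a (b ∷ l) h =
  trans (cong (has21below a (b ∷ l) ∨_) h) (∨-zeroʳ _) All.∷ AllP.map⁺ (step (contains321 l) refl)
  where
  step : ∀ v → contains321 l ≡ v → All (λ π → contains321 (b ∷ π) ≡ true) (insertions a l)
  step true  e = All.map (λ {π} e' → trans (cong (has21below b π ∨_) e') (∨-zeroʳ _)) (contains321-insertions a l e)
  step false e = All.map (λ {π} e' → cong (_∨ contains321 π) e')
    (has21below-insertions b a l (trans (sym (∨-identityʳ _)) (trans (cong (has21below b l ∨_) (sym e)) h)))

avoidWeight : (ℕ → ℤ) → (ℕ → ℤ) → List ℕ → ℤ
avoidWeight t z π = if not (contains321 π) then weight t z π else + 0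

avoidWeight-map-suc : ∀ t z τ → avoidWeight t z (map suc τ) ≡ avoidWeight t z τ
avoidWeight-map-suc t z τ =
  cong₂ (λ b w → if not b then w else + 0) (contains321-map-suc τ) (weight-map-suc t z τ)

avoidWeight-ascent : ∀ t z b c π → (c <ᵇ b) ≡ false →
  avoidWeight t z (b ∷ c ∷ π) ≡ avoidWeight (sh t) (sh z) (c ∷ π)
avoidWeight-ascent t z b c π e =
  bool-identity (c <ᵇ b) (any (_<ᵇ c) π) (has21below b π) (has21below c π) (contains321 π)
                (λ w → weightStep w t z (c ∷ π)) e (has21below-mono b c π e)
  where
  bool-identity : ∀ (cb P hbb hbc cc : Bool) (W : Bool → ℤ) → cb ≡ false → (hbc ≡ false → hbb ≡ false) →
    (if not (((cb ∧ P) ∨ hbb) ∨ (hbc ∨ cc)) then W cb else + 0) ≡ (if not (hbc ∨ cc) then W false else + 0)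
  bool-identity false P hbb true  cc    W refl m = cong (λ v → if not v then W false else + 0) (∨-zeroʳ hbb)
  bool-identity false P hbb false true  W refl m = cong (λ v → if not v then W false else + 0) (∨-zeroʳ hbb)
  bool-identity false P hbb false false W refl m rewrite m refl = refl

avoidWeight-321 : ∀ t z b c π → (c <ᵇ b) ≡ true → any (_<ᵇ c) π ≡ true → avoidWeight t z (b ∷ c ∷ π) ≡ + 0
avoidWeight-321 t z b c π e p = vanish (c <ᵇ b) (any (_<ᵇ c) π) (has21below b π) (contains321 (c ∷ π)) e p
  where
  vanish : ∀ (cb P hbb rest : Bool) → cb ≡ true → P ≡ true →
    (if not (((cb ∧ P) ∨ hbb) ∨ rest) then weight t z (b ∷ c ∷ π) else + 0) ≡ + 0
  vanish true true hbb rest refl refl = refl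

-- Words on the letters ≥ 2, into which 1 is inserted.
up2 : List ℕ → List ℕ
up2 τ = map suc (map suc τ)

contains321-up2 : ∀ τ → contains321 (up2 τ) ≡ contains321 τ
contains321-up2 τ = trans (contains321-map-suc (map suc τ)) (contains321-map-suc τ)

length-up2 : ∀ τ → length (up2 τ) ≡ length τ
length-up2 τ = trans (length-map suc (map suc τ)) (length-map suc τ)

avoidWeight-b1 : ∀ t z x y' τ → contains321 (up2 (x ∷ y' ∷ τ)) ≡ false →
  avoidWeight t z (suc (suc x) ∷ 1 ∷ up2 (y' ∷ τ)) ≡ t 1 * (+ 1 * xDesFrom z 3 (up2 (y' ∷ τ)))
avoidWeight-b1 t z x y' τ h =
  cong (λ v → if not v then weight t z (suc (suc x) ∷ 1 ∷ up2 (y' ∷ τ)) else + 0) avoids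
  where
  avoids : contains321 (suc (suc x) ∷ 1 ∷ up2 (y' ∷ τ)) ≡ false
  avoids rewrite anyBelow-1 (map suc τ) | has21below-1 (map suc (y' ∷ τ))
               | proj₁ (∨-false (has21below (suc (suc x)) (up2 (y' ∷ τ))) (contains321 (up2 (y' ∷ τ))) h)
               | proj₂ (∨-false (has21below (suc (suc x)) (up2 (y' ∷ τ))) (contains321 (up2 (y' ∷ τ))) h) = refl

partialSum : (ℕ → ℤ) → ℕ → ℤ
partialSum t zero    = + 0
partialSum t (suc a) = t 1 + partialSum (sh t) a

-- The head weight after inserting 1 into a 321-avoiding word whose first descent
-- is at d (d = length if increasing), with y the shifted descent variables:
-- 1 in front gives t (d+1); 1 right after the descent top gives t d; 1 right after
-- position p < d gives t p · y d; any later position creates a 321.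
insertHead : (ℕ → ℤ) → (ℕ → ℤ) → ℕ → ℤ
insertHead t y zero    = t 1
insertHead t y (suc a) = t (suc (suc a)) + t (suc a) + y (suc a) * partialSum t a

insertAfter : (ℕ → ℤ) → (ℕ → ℤ) → ℕ → List ℕ → ℤ
insertAfter t z b σ = sumℤ (map (λ π → avoidWeight t z (b ∷ π)) (insertions 1 σ))

-- Shifting the head weight by one position commutes with insertHead, up to the
-- contribution of "1 right after position 1".
insertHead-shift : ∀ t y a → insertHead (sh t) (sh y) (suc a) + y (suc (suc a)) * t 1 ≡ insertHead t y (suc (suc a))
insertHead-shift t y a = regroup (t (suc (suc (suc a)))) (t (suc (suc a))) (y (suc (suc a))) (t 1) (partialSum (sh t) a)
  where
  regroup : ∀ (a b y t s : ℤ) → a + b + y * s + y * t ≡ a + b + y * (t + s)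
  regroup = solve-∀

-- b c σ with a descent at the head: inserting 1 after b only works as b 1 c σ.
insertAfter-descent : ∀ x y' τ t z → (y' <ᵇ x) ≡ true → contains321 (up2 (x ∷ y' ∷ τ)) ≡ false →
  weight (sh t) (sh z) (up2 (x ∷ y' ∷ τ)) + insertAfter t z (suc (suc x)) (up2 (y' ∷ τ))
    ≡ weight (insertHead t (sh z)) (sh z) (up2 (x ∷ y' ∷ τ))
insertAfter-descent x y' τ t z e h = begin
    weightStep (y' <ᵇ x) (sh t) (sh z) (c ∷ σ) + (avoidWeight t z (b ∷ 1 ∷ c ∷ σ) + later)
  ≡⟨ cong₂ _+_ (cong (λ w → weightStep w (sh t) (sh z) (c ∷ σ)) e) (cong₂ _+_ (avoidWeight-b1 t z x y' τ h) laterVanish) ⟩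
    t 2 * X + (t 1 * (+ 1 * xDesFrom z 3 (c ∷ σ)) + + 0)
  ≡⟨ cong (λ w → t 2 * X + (t 1 * (+ 1 * w) + + 0)) (xDesFrom-shift z 2 (c ∷ σ)) ⟩
    t 2 * X + (t 1 * (+ 1 * X) + + 0)
  ≡⟨ collect (t 2) (t 1) (z 2) X ⟩
    (t 2 + t 1 + z 2 * + 0) * X
  ≡⟨ cong (λ w → weightStep w (insertHead t (sh z)) (sh z) (c ∷ σ)) (sym e) ⟩
    weightStep (y' <ᵇ x) (insertHead t (sh z)) (sh z) (c ∷ σ)
  ∎
  where
  open ≡-Reasoning
  b = suc (suc x)
  c = suc (suc y')
  σ = up2 τ
  X = xDesFrom (sh z) 2 (c ∷ σ)
  later = sumℤ (map (λ π → avoidWeight t z (b ∷ π)) (map (c ∷_) (insertions 1 σ)))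
  laterVanish : later ≡ + 0
  laterVanish = trans (sum-map-∘ (λ π → avoidWeight t z (b ∷ π)) (c ∷_) (insertions 1 σ))
    (trans (sum-congᴬ (All.map (avoidWeight-321 t z b c _ e) (anyBelow-insert1 y' σ))) (sum-zero (insertions 1 σ)))
  collect : ∀ (a b c x : ℤ) → a * x + (b * (+ 1 * x) + + 0) ≡ (a + b + c * + 0) * x
  collect = solve-∀

-- b c σ with an ascent at the head: the letter b is inert, so recurse on c σ.
insertAfter-ascent : ∀ x y' τ t z → (y' <ᵇ x) ≡ false → contains321 (up2 (x ∷ y' ∷ τ)) ≡ false →
  z (suc (length (up2 (x ∷ y' ∷ τ)))) ≡ + 1 →
  weight (sh (sh t)) (sh (sh z)) (up2 (y' ∷ τ)) + insertAfter (sh t) (sh z) (suc (suc y')) (up2 τ)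
    ≡ weight (insertHead (sh t) (sh (sh z))) (sh (sh z)) (up2 (y' ∷ τ)) →
  weight (sh t) (sh z) (up2 (x ∷ y' ∷ τ)) + insertAfter t z (suc (suc x)) (up2 (y' ∷ τ))
    ≡ weight (insertHead t (sh z)) (sh z) (up2 (x ∷ y' ∷ τ))
insertAfter-ascent x y' τ t z e h hz IH = begin
    weightStep (y' <ᵇ x) (sh t) (sh z) (c ∷ σ) + (avoidWeight t z (b ∷ 1 ∷ c ∷ σ) + later)
  ≡⟨ cong₂ _+_ (cong (λ w → weightStep w (sh t) (sh z) (c ∷ σ)) e) (cong₂ _+_ (avoidWeight-b1 t z x y' τ h) laterShift) ⟩
    weight (sh (sh t)) (sh (sh z)) (c ∷ σ) + (t 1 * (+ 1 * X) + insertAfter (sh t) (sh z) c σ)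
  ≡⟨ regroup (weight (sh (sh t)) (sh (sh z)) (c ∷ σ)) (t 1) X (insertAfter (sh t) (sh z) c σ) ⟩
    (weight (sh (sh t)) (sh (sh z)) (c ∷ σ) + insertAfter (sh t) (sh z) c σ) + X * t 1
  ≡⟨ cong₂ _+_ IH (cong (_* t 1) X≡weight) ⟩
    weight (insertHead (sh t) (sh y)) (sh y) (c ∷ σ) + weight (sh y) (sh y) (c ∷ σ) * t 1
  ≡⟨ cong (_+_ (weight (insertHead (sh t) (sh y)) (sh y) (c ∷ σ))) (sym (weight-scaleʳ (sh y) (t 1) (sh y) (c ∷ σ))) ⟩
    weight (insertHead (sh t) (sh y)) (sh y) (c ∷ σ) + weight (λ a → sh y a * t 1) (sh y) (c ∷ σ)
  ≡⟨ sym (weight-+ (insertHead (sh t) (sh y)) (λ a → sh y a * t 1) (sh y) (c ∷ σ)) ⟩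
    weight (λ a → insertHead (sh t) (sh y) a + sh y a * t 1) (sh y) (c ∷ σ)
  ≡⟨ weight-cong⁺ (sh y) c σ (insertHead-shift t y) ⟩
    weight (sh (insertHead t y)) (sh y) (c ∷ σ)
  ≡⟨ cong (λ w → weightStep w (insertHead t y) y (c ∷ σ)) (sym e) ⟩
    weightStep (y' <ᵇ x) (insertHead t y) y (c ∷ σ)
  ∎
  where
  open ≡-Reasoning
  b = suc (suc x)
  c = suc (suc y')
  σ = up2 τ
  y = sh z
  X = xDesFrom z 3 (c ∷ σ)
  later = sumℤ (map (λ π → avoidWeight t z (b ∷ π)) (map (c ∷_) (insertions 1 σ)))
  laterShift : later ≡ insertAfter (sh t) (sh z) c σ
  laterShift = trans (sum-map-∘ (λ π → avoidWeight t z (b ∷ π)) (c ∷_) (insertions 1 σ))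
                     (sum-cong (λ π → avoidWeight-ascent t z b c π e) (insertions 1 σ))
  -- 1 inserted right after b: the descent b > 1 heads a copy of c σ with all weights shifted.
  X≡weight : X ≡ weight (sh y) (sh y) (c ∷ σ)
  X≡weight = trans (xDesFrom-shift z 2 (c ∷ σ))
    (trans (xDesFrom-shift (sh z) 1 (c ∷ σ)) (xDes≡weight c (sh y) (sh y) σ (λ _ → refl) hz))
  regroup : ∀ (a b x r : ℤ) → a + (b * (+ 1 * x) + r) ≡ (a + r) + x * b
  regroup = solve-∀

insertAfter-head : ∀ x τ t z → contains321 (up2 (x ∷ τ)) ≡ false → z (suc (length (up2 (x ∷ τ)))) ≡ + 1 →
  weight (sh t) (sh z) (up2 (x ∷ τ)) + insertAfter t z (suc (suc x)) (up2 τ) ≡ weight (insertHead t (sh z)) (sh z) (up2 (x ∷ τ))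
insertAfter-head x []       t z h hz = single (t 2) (t 1) (z 2)
  where
  single : ∀ (a b c : ℤ) → a + (b * + 1 + + 0) ≡ a + b + c * + 0
  single = solve-∀
insertAfter-head x (y' ∷ τ) t z h hz = byHead (y' <ᵇ x) refl
  where
  rest = proj₂ (∨-false (has21below (suc (suc x)) (up2 (y' ∷ τ))) (contains321 (up2 (y' ∷ τ))) h)
  byHead : ∀ v → (y' <ᵇ x) ≡ v →
    weight (sh t) (sh z) (up2 (x ∷ y' ∷ τ)) + insertAfter t z (suc (suc x)) (up2 (y' ∷ τ))
      ≡ weight (insertHead t (sh z)) (sh z) (up2 (x ∷ y' ∷ τ))
  byHead true  e = insertAfter-descent x y' τ t z e h
  byHead false e = insertAfter-ascent x y' τ t z e h hz (insertAfter-head y' τ (sh t) (sh z) rest hz)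

insert1-avoiding : ∀ τ t z → contains321 (up2 τ) ≡ false → z (suc (length (up2 τ))) ≡ + 1 →
  sumℤ (map (avoidWeight t z) (insertions 1 (up2 τ))) ≡ weight (insertHead t (sh z)) (sh z) (up2 τ)
insert1-avoiding []      t z h hz = ℤP.+-identityʳ (t 1)
insert1-avoiding (x ∷ τ) t z h hz =
  trans (cong₂ _+_ oneInFront (sum-map-∘ (avoidWeight t z) (suc (suc x) ∷_) (insertions 1 (up2 τ))))
        (insertAfter-head x τ t z h hz)
  where
  -- 1 in front is an ascent and creates no 321.
  oneInFront : avoidWeight t z (1 ∷ up2 (x ∷ τ)) ≡ weight (sh t) (sh z) (up2 (x ∷ τ))
  oneInFront = cong (λ v → if not v then weight (sh t) (sh z) (up2 (x ∷ τ)) else + 0)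
                    (cong₂ _∨_ (has21below-1 (map suc (x ∷ τ))) h)

-- The same for an arbitrary word τ: if τ contains 321, so does every insertion.
insert1 : ∀ τ t z → z (suc (length τ)) ≡ + 1 →
  sumℤ (map (avoidWeight t z) (insertions 1 (up2 τ))) ≡ avoidWeight (insertHead t (sh z)) (sh z) τ
insert1 τ t z hz = byPattern (contains321 τ) refl
  where
  t' = insertHead t (sh z)
  byPattern : ∀ v → contains321 τ ≡ v →
    sumℤ (map (avoidWeight t z) (insertions 1 (up2 τ))) ≡ avoidWeight t' (sh z) τ
  byPattern false e =
    trans (insert1-avoiding τ t z (trans (contains321-up2 τ) e) (trans (cong (λ k → z (suc k)) (length-up2 τ)) hz))
    (trans (trans (weight-map-suc t' (sh z) (map suc τ)) (weight-map-suc t' (sh z) τ))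
           (sym (cong (λ v → if not v then weight t' (sh z) τ else + 0) e)))
  byPattern true e =
    trans (trans (sum-congᴬ (All.map (λ {π} e' → cong (λ v → if not v then weight t z π else + 0) e')
                                     (contains321-insertions 1 (up2 τ) (trans (contains321-up2 τ) e))))
                 (sum-zero (insertions 1 (up2 τ))))
          (sym (cong (λ v → if not v then weight t' (sh z) τ else + 0) e))

Φ : ℕ → (ℕ → ℤ) → (ℕ → ℤ) → ℤ
Φ m t y = sumℤ (map (weight t y) (Sn321 m))

Φ-masked : ∀ m t y → Φ m t y ≡ sumℤ (map (avoidWeight t y) (perms (upTo m)))
Φ-masked m t y = trans (sum-filter (λ π → not (contains321 π)) (weight t y) (Sn m))
  (trans (cong (λ P → sumℤ (map (avoidWeight t y) P)) (perms-map suc (upTo m)))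
  (trans (sum-map-∘ (avoidWeight t y) (map suc) (perms (upTo m)))
         (sum-cong (avoidWeight-map-suc t y) (perms (upTo m)))))

-- The insertion recursion: every permutation of [m+1] arises uniquely by inserting 1
-- into a permutation of {2, …, m+1}.
Φ-insertion : ∀ m t z → z (suc m) ≡ + 1 → Φ (suc m) t z ≡ Φ m (insertHead t (sh z)) (sh z)
Φ-insertion m t z hz = begin
    Φ (suc m) t z
  ≡⟨ sum-filter (λ π → not (contains321 π)) (weight t z) (Sn (suc m)) ⟩
    sumℤ (map (avoidWeight t z) (perms (range1 (suc m))))
  ≡⟨ cong (λ l → sumℤ (map (avoidWeight t z) (perms l))) (range1-suc m) ⟩
    sumℤ (map (avoidWeight t z) (concatMap (insertions 1) (perms (up2 U))))
  ≡⟨ cong (λ P → sumℤ (map (avoidWeight t z) (concatMap (insertions 1) P))) relabel ⟩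
    sumℤ (map (avoidWeight t z) (concatMap (insertions 1) (map up2 (perms U))))
  ≡⟨ sum-concatMap (avoidWeight t z) (insertions 1) (map up2 (perms U)) ⟩
    sumℤ (map (λ σ → sumℤ (map (avoidWeight t z) (insertions 1 σ))) (map up2 (perms U)))
  ≡⟨ sum-map-∘ (λ σ → sumℤ (map (avoidWeight t z) (insertions 1 σ))) up2 (perms U) ⟩
    sumℤ (map (λ τ → sumℤ (map (avoidWeight t z) (insertions 1 (up2 τ)))) (perms U))
  ≡⟨ sum-congᴬ (All.map (λ {τ} e → insert1 τ t z (trans (cong (λ k → z (suc k)) (trans e (length-upTo m))) hz))
                        (length-perms U)) ⟩
    sumℤ (map (avoidWeight (insertHead t (sh z)) (sh z)) (perms U))
  ≡⟨ sym (Φ-masked m (insertHead t (sh z)) (sh z)) ⟩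
    Φ m (insertHead t (sh z)) (sh z)
  ∎
  where
  open ≡-Reasoning
  U = upTo m
  relabel : perms (up2 U) ≡ map up2 (perms U)
  relabel = trans (perms-map suc (map suc U))
    (trans (cong (map (map suc)) (perms-map suc U)) (sym (map-∘ (perms U))))

Φ-empty : ∀ t y → Φ 0 t y ≡ t 0
Φ-empty t y = ℤP.+-identityʳ (t 0)

Φ-cong : ∀ m {f h} y → (∀ a → f a ≡ h a) → Φ m f y ≡ Φ m h y
Φ-cong m y e = sum-cong (λ π → weight-cong y π e) (Sn321 m)

Φ-+ : ∀ m f h y → Φ m (λ a → f a + h a) y ≡ Φ m f y + Φ m h y
Φ-+ m f h y = trans (sum-cong (λ π → weight-+ f h y π) (Sn321 m)) (sum-+ (weight f y) (weight h y) (Sn321 m))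

Φ-scale : ∀ m k f y → Φ m (λ a → k * f a) y ≡ k * Φ m f y
Φ-scale m k f y = trans (sum-cong (λ π → weight-scaleˡ k f y π) (Sn321 m)) (sum-scale k (weight f y) (Sn321 m))

Φ-zero : ∀ m y → Φ m (λ _ → + 0) y ≡ + 0
Φ-zero m y = trans (sum-cong (λ π → weight-zero y π) (Sn321 m)) (sum-zero (Sn321 m))

-- Sparse-subset polynomials:
-- sparsePoly c L w = Σ { c |T| · Π_{j∈T} w_j : T ⊆ [L] without two consecutive
-- elements }, defined through its recursion on whether 1 ∈ T.

sparsePoly : (ℕ → ℤ) → ℕ → (ℕ → ℤ) → ℤ
sparsePoly c zero          w = c 0
sparsePoly c (suc zero)    w = c 0 + w 1 * c 1
sparsePoly c (suc (suc L)) w = sparsePoly c (suc L) (sh w) + w 1 * sparsePoly (c ∘ suc) L (sh (sh w))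

-- The recursion in uniform form, valid also for L = 0.
sparsePoly-suc : ∀ c L w → sparsePoly c (suc L) w ≡ sparsePoly c L (sh w) + w 1 * sparsePoly (c ∘ suc) (pred L) (sh (sh w))
sparsePoly-suc c zero    w = refl
sparsePoly-suc c (suc L) w = refl

sparsePoly-congᶜ : ∀ {c c'} L w → (∀ j → j ≤ℕ L → c j ≡ c' j) → sparsePoly c L w ≡ sparsePoly c' L w
sparsePoly-congᶜ zero          w e = e 0 z≤n
sparsePoly-congᶜ (suc zero)    w e = cong₂ _+_ (e 0 z≤n) (cong (w 1 *_) (e 1 (s≤s z≤n)))
sparsePoly-congᶜ (suc (suc L)) w e =
  cong₂ _+_ (sparsePoly-congᶜ (suc L) (sh w) (λ j le → e j (ℕP.≤-trans le (ℕP.n≤1+n _))))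
            (cong (w 1 *_) (sparsePoly-congᶜ L (sh (sh w)) (λ j le → e (suc j) (s≤s (ℕP.≤-trans le (ℕP.n≤1+n _))))))

sparsePoly-congʷ : ∀ c L {w w'} → (∀ j → j <ℕ L → w (suc j) ≡ w' (suc j)) → sparsePoly c L w ≡ sparsePoly c L w'
sparsePoly-congʷ c zero          e = refl
sparsePoly-congʷ c (suc zero)    e = cong (λ v → c 0 + v * c 1) (e 0 (s≤s z≤n))
sparsePoly-congʷ c (suc (suc L)) e =
  cong₂ _+_ (sparsePoly-congʷ c (suc L) (λ j lt → e (suc j) (s≤s lt)))
            (cong₂ _*_ (e 0 (s≤s z≤n)) (sparsePoly-congʷ (c ∘ suc) L (λ j lt → e (suc (suc j)) (s≤s (s≤s lt)))))

sparsePoly-+ : ∀ c d L w → sparsePoly (λ j → c j + d j) L w ≡ sparsePoly c L w + sparsePoly d L w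
sparsePoly-+ c d zero          w = refl
sparsePoly-+ c d (suc zero)    w = distrib (c 0) (d 0) (c 1) (d 1) (w 1)
  where
  distrib : ∀ (a b c d w : ℤ) → a + b + w * (c + d) ≡ a + w * c + (b + w * d)
  distrib = solve-∀
sparsePoly-+ c d (suc (suc L)) w =
  trans (cong₂ (λ p q → p + w 1 * q) (sparsePoly-+ c d (suc L) (sh w)) (sparsePoly-+ (c ∘ suc) (d ∘ suc) L (sh (sh w))))
        (distrib (sparsePoly c (suc L) (sh w)) (sparsePoly d (suc L) (sh w))
                 (sparsePoly (c ∘ suc) L (sh (sh w))) (sparsePoly (d ∘ suc) L (sh (sh w))) (w 1))
  where
  distrib : ∀ (a b c d w : ℤ) → a + b + w * (c + d) ≡ a + w * c + (b + w * d)
  distrib = solve-∀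

sparsePoly-zero : ∀ L w → sparsePoly (λ _ → + 0) L w ≡ + 0
sparsePoly-zero zero          w = refl
sparsePoly-zero (suc zero)    w = trans (ℤP.+-identityˡ _) (ℤP.*-zeroʳ (w 1))
sparsePoly-zero (suc (suc L)) w =
  trans (cong₂ (λ p q → p + w 1 * q) (sparsePoly-zero (suc L) (sh w)) (sparsePoly-zero L (sh (sh w))))
        (trans (ℤP.+-identityˡ _) (ℤP.*-zeroʳ (w 1)))

term : (ℕ → ℤ) → (ℕ → ℤ) → List ℕ → ℤ
term c w T = if noConsec T then c (length T) * prodℤ (map w T) else + 0

termNo1 : (ℕ → ℤ) → (ℕ → ℤ) → List ℕ → ℤ
termNo1 c w T = if not (elemℕ 1 T) ∧ noConsec T then c (length T) * prodℤ (map w T) else + 0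

subsetSum : ℕ → (ℕ → ℤ) → (ℕ → ℤ) → ℤ
subsetSum L c w = sumℤ (map (term c w) (subsets (range1 L)))

subsetSumNo1 : ℕ → (ℕ → ℤ) → (ℕ → ℤ) → ℤ
subsetSumNo1 L c w = sumℤ (map (termNo1 c w) (subsets (range1 L)))

subsets-map : ∀ (f : ℕ → ℕ) l → subsets (map f l) ≡ map (map f) (subsets l)
subsets-map f []      = refl
subsets-map f (a ∷ l) = begin
    subsets (map f l) ++ map (f a ∷_) (subsets (map f l))
  ≡⟨ cong (λ S → S ++ map (f a ∷_) S) (subsets-map f l) ⟩
    map (map f) (subsets l) ++ map (f a ∷_) (map (map f) (subsets l))
  ≡⟨ cong (map (map f) (subsets l) ++_) (trans (sym (map-∘ (subsets l))) (map-∘ (subsets l))) ⟩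
    map (map f) (subsets l) ++ map (map f) (map (a ∷_) (subsets l))
  ≡⟨ sym (map-++ (map f) (subsets l) _) ⟩
    map (map f) (subsets l ++ map (a ∷_) (subsets l))
  ∎
  where open ≡-Reasoning

subsets-range1-suc : ∀ L → subsets (range1 (suc L)) ≡ map (map suc) (subsets (range1 L)) ++ map (1 ∷_) (map (map suc) (subsets (range1 L)))
subsets-range1-suc L = trans (cong subsets (range1-suc L)) (cong (λ S → S ++ map (1 ∷_) S) (subsets-map suc (range1 L)))

elem-map-suc : ∀ j T → elemℕ (suc j) (map suc T) ≡ elemℕ j T
elem-map-suc j []      = refl
elem-map-suc j (x ∷ T) = cong ((j ≡ᵇ x) ∨_) (elem-map-suc j T)

elem0-map-suc : ∀ T → elemℕ 0 (map suc T) ≡ false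
elem0-map-suc []      = refl
elem0-map-suc (x ∷ T) = elem0-map-suc T

all-map-suc : ∀ (p q : ℕ → Bool) T → (∀ x → p (suc x) ≡ q x) → all p (map suc T) ≡ all q T
all-map-suc p q []      e = refl
all-map-suc p q (x ∷ T) e = cong₂ _∧_ (e x) (all-map-suc p q T e)

noConsec-map-suc : ∀ T → noConsec (map suc T) ≡ noConsec T
noConsec-map-suc T = all-map-suc _ _ T (λ x → cong not (elem-map-suc (suc x) T))

noConsec-1∷ : ∀ T → noConsec (1 ∷ map suc T) ≡ not (elemℕ 1 T) ∧ noConsec T
noConsec-1∷ T = cong₂ _∧_ (cong not (elem-map-suc 1 T)) (all-map-suc _ _ T (λ x → cong not (elem-map-suc (suc x) T)))

prod-map-suc : ∀ (w : ℕ → ℤ) T → prodℤ (map w (map suc T)) ≡ prodℤ (map (sh w) T)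
prod-map-suc w T = cong prodℤ (sym (map-∘ T))

mask-cong : ∀ {b b' : Bool} {x x' y y' : ℤ} → b ≡ b' → x ≡ x' → y ≡ y' →
  (if b then x * y else + 0) ≡ (if b' then x' * y' else + 0)
mask-cong refl refl refl = refl

term-map-suc : ∀ c w T → term c w (map suc T) ≡ term c (sh w) T
term-map-suc c w T = mask-cong (noConsec-map-suc T) (cong c (length-map suc T)) (prod-map-suc w T)

-- A set containing 1: factor out w 1; the rest avoids 2.
term-1∷ : ∀ c w T → term c w (1 ∷ map suc T) ≡ w 1 * termNo1 (c ∘ suc) (sh w) T
term-1∷ c w T =
  trans (cong₂ (λ b v → if b then c (suc v) * (w 1 * prodℤ (map w (map suc T))) else + 0) (noConsec-1∷ T) (length-map suc T))
  (trans (cong (λ p → if not (elemℕ 1 T) ∧ noConsec T then c (suc (length T)) * (w 1 * p) else + 0) (prod-map-suc w T))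
         (factor (not (elemℕ 1 T) ∧ noConsec T) (c (suc (length T))) (prodℤ (map (sh w) T))))
  where
  factor : ∀ (b : Bool) (x y : ℤ) → (if b then x * (w 1 * y) else + 0) ≡ w 1 * (if b then x * y else + 0)
  factor true  x y = swap (w 1) x y
    where
    swap : ∀ (w x y : ℤ) → x * (w * y) ≡ w * (x * y)
    swap = solve-∀
  factor false x y = sym (ℤP.*-zeroʳ (w 1))

termNo1-up2 : ∀ c w T → termNo1 c w (up2 T) ≡ term c (sh w) (map suc T)
termNo1-up2 c w T =
  mask-cong (cong₂ _∧_ (cong not (trans (elem-map-suc 0 (map suc T)) (elem0-map-suc T))) (noConsec-map-suc (map suc T)))
            (cong c (length-map suc (map suc T))) (prod-map-suc w (map suc T))

subsetSum-suc : ∀ L c w → subsetSum (suc L) c w ≡ subsetSum L c (sh w) + w 1 * subsetSumNo1 L (c ∘ suc) (sh w)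
subsetSum-suc L c w = trans (cong (λ S → sumℤ (map (term c w) S)) (subsets-range1-suc L))
  (trans (cong sumℤ (map-++ (term c w) (map (map suc) S0) _))
  (trans (sum-++ (map (term c w) (map (map suc) S0)) _)
  (cong₂ _+_ (trans (sum-map-∘ (term c w) (map suc) S0) (sum-cong (term-map-suc c w) S0))
             (trans (sum-map-∘ (term c w) (1 ∷_) (map (map suc) S0))
             (trans (sum-map-∘ (λ T → term c w (1 ∷ T)) (map suc) S0)
             (trans (sum-cong (term-1∷ c w) S0) (sum-scale (w 1) (termNo1 (c ∘ suc) (sh w)) S0)))))))
  where
  S0 = subsets (range1 L)

subsetSumNo1-suc : ∀ L c w → subsetSumNo1 (suc L) c w ≡ subsetSum L c (sh w)
subsetSumNo1-suc L c w = trans (cong (λ S → sumℤ (map (termNo1 c w) S)) (subsets-range1-suc L))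
  (trans (cong sumℤ (map-++ (termNo1 c w) (map (map suc) S0) _))
  (trans (sum-++ (map (termNo1 c w) (map (map suc) S0)) _)
  (trans (cong₂ _+_ without1 with1) (ℤP.+-identityʳ _))))
  where
  S0 = subsets (range1 L)
  S1 = subsets (upTo L)
  without1 : sumℤ (map (termNo1 c w) (map (map suc) S0)) ≡ subsetSum L c (sh w)
  without1 = trans (sum-map-∘ (termNo1 c w) (map suc) S0)
    (trans (cong (λ S → sumℤ (map (λ T → termNo1 c w (map suc T)) S)) (subsets-map suc (upTo L)))
    (trans (sum-map-∘ (λ T → termNo1 c w (map suc T)) (map suc) S1)
    (trans (sum-cong (termNo1-up2 c w) S1)
    (trans (sym (sum-map-∘ (term c (sh w)) (map suc) S1))
           (cong (λ S → sumℤ (map (term c (sh w)) S)) (sym (subsets-map suc (upTo L))))))))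
  with1 : sumℤ (map (termNo1 c w) (map (1 ∷_) (map (map suc) S0))) ≡ + 0
  with1 = trans (sum-map-∘ (termNo1 c w) (1 ∷_) (map (map suc) S0)) (sum-zero (map (map suc) S0))

subsetSum≡sparsePoly : ∀ L c w → subsetSum L c w ≡ sparsePoly c L w
subsetSum≡sparsePoly zero          c w = unit (c 0)
  where
  unit : ∀ (a : ℤ) → a * + 1 + + 0 ≡ a
  unit = solve-∀
subsetSum≡sparsePoly (suc zero)    c w = trans (subsetSum-suc 0 c w) (units (c 0) (c 1) (w 1))
  where
  units : ∀ (a b w : ℤ) → a * + 1 + + 0 + w * (b * + 1 + + 0) ≡ a + w * b
  units = solve-∀
subsetSum≡sparsePoly (suc (suc L)) c w =
  trans (subsetSum-suc (suc L) c w)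
        (cong₂ (λ p q → p + w 1 * q) (subsetSum≡sparsePoly (suc L) c (sh w))
               (trans (subsetSumNo1-suc L (c ∘ suc) (sh w)) (subsetSum≡sparsePoly L (c ∘ suc) (sh (sh w)))))

rhs≡sparsePoly : ∀ n x → rhs n x ≡ sparsePoly (λ k → + catalan (n ∸ k)) (n ∸ 1) (λ j → x j - + 1)
rhs≡sparsePoly n x =
  trans (sum-filter noConsec (λ T → + catalan (n ∸ length T) * prodℤ (map (λ j → x j - + 1) T)) (subsets (range1 (n ∸ 1))))
        (subsetSum≡sparsePoly (n ∸ 1) (λ k → + catalan (n ∸ k)) (λ j → x j - + 1))

-- Ballot numbers:
-- ballot (M+1) (a+1) = Σ_{j ≥ a} ballot M j: the ballot triangle, with
-- ballot M M = 1 and ballot M a = 0 for a > M.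

mutual
  ballot : ℕ → ℕ → ℕ
  ballot zero    zero    = 1
  ballot zero    (suc a) = 0
  ballot (suc M) zero    = 0
  ballot (suc M) (suc a) = ballotTail M a (suc M ∸ a)

  ballotTail : ℕ → ℕ → ℕ → ℕ
  ballotTail M a zero    = 0
  ballotTail M a (suc n) = ballot M a +ℕ ballotTail M (suc a) n

ballot-vanish : ∀ M a → M <ℕ a → ballot M a ≡ 0
ballot-vanish zero    (suc a) _ = refl
ballot-vanish (suc M) (suc a) (s≤s le) rewrite ℕP.m≤n⇒m∸n≡0 le = refl

ballot-rec : ∀ M a → ballot (suc M) (suc a) ≡ ballot M a +ℕ ballot (suc M) (suc (suc a))
ballot-rec M a with ℕP.≤-<-connex a M
... | inj₁ le rewrite ℕP.+-∸-assoc 1 le = refl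
... | inj₂ lt rewrite ℕP.m≤n⇒m∸n≡0 lt | ballot-vanish M a lt | ℕP.m≤n⇒m∸n≡0 (ℕP.≤-trans (ℕP.n≤1+n M) lt) = refl

ballot-diag : ∀ M → ballot M M ≡ 1
ballot-diag zero    = refl
ballot-diag (suc M) rewrite ℕP.m+n∸n≡m 1 M | ballot-diag M = refl

-- Closed form: ballot (a+p+1) (a+1) = C(a+2p, a+p) - C(a+2p, a+p+1), kept additive.
ballot-binomial : ∀ p a → ballot (suc (a +ℕ p)) (suc a) +ℕ ((a +ℕ p +ℕ p) C suc (a +ℕ p)) ≡ (a +ℕ p +ℕ p) C (a +ℕ p)
ballot-binomial zero a rewrite ℕP.+-identityʳ a | ℕP.+-identityʳ a | ballot-diag (suc a) | k>n⇒nCk≡0 (ℕP.n<1+n a) = sym (nCn≡1 a)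
ballot-binomial (suc p) zero    = firstColumn p (ballot-binomial p 1)
  where
  symmetric : ∀ p → suc (p +ℕ p) C p ≡ suc (p +ℕ p) C suc p
  symmetric p = trans (nCk≡nC[n∸k] (ℕP.≤-trans (ℕP.m≤m+n p p) (ℕP.n≤1+n _))) (cong (suc (p +ℕ p) C_) (ℕP.m+n∸n≡m (suc p) p))
  combine : ∀ B C0 C1 C2 → B +ℕ C2 ≡ C1 → C0 ≡ C1 → B +ℕ (C1 +ℕ C2) ≡ C0 +ℕ C1
  combine B C0 C1 C2 e1 e2 = trans (shuffle B C1 C2) (trans (cong (C1 +ℕ_) e1) (cong (_+ℕ C1) (sym e2)))
    where
    shuffle : ∀ B C1 C2 → B +ℕ (C1 +ℕ C2) ≡ C1 +ℕ (B +ℕ C2)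
    shuffle = ℕ-Solver.solve-∀
  firstColumn : ∀ p → ballot (suc (suc p)) 2 +ℕ (suc (p +ℕ p) C suc (suc p)) ≡ suc (p +ℕ p) C suc p →
    ballot (suc (suc p)) 1 +ℕ ((suc p +ℕ suc p) C suc (suc p)) ≡ (suc p +ℕ suc p) C suc p
  firstColumn p ih rewrite ℕP.+-suc p p =
    trans (cong₂ _+ℕ_ (ballot-rec (suc p) 0) (sym (nCk+nC[k+1]≡[n+1]C[k+1] (suc (p +ℕ p)) (suc p))))
    (trans (combine (ballot (suc (suc p)) 2) (suc (p +ℕ p) C p) (suc (p +ℕ p) C suc p) (suc (p +ℕ p) C suc (suc p)) ih (symmetric p))
           (nCk+nC[k+1]≡[n+1]C[k+1] (suc (p +ℕ p)) p))
ballot-binomial (suc p) (suc a) = inner a p (ballot-binomial (suc p) a) (ballot-binomial p (suc (suc a)))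
  where
  combine : ∀ B1 B2 P1 P2 P3 → B1 +ℕ P2 ≡ P1 → B2 +ℕ P3 ≡ P2 → (B1 +ℕ B2) +ℕ (P2 +ℕ P3) ≡ P1 +ℕ P2
  combine B1 B2 P1 P2 P3 e1 e2 = trans (shuffle B1 B2 P2 P3) (cong₂ _+ℕ_ e1 e2)
    where
    shuffle : ∀ B1 B2 P2 P3 → (B1 +ℕ B2) +ℕ (P2 +ℕ P3) ≡ (B1 +ℕ P2) +ℕ (B2 +ℕ P3)
    shuffle = ℕ-Solver.solve-∀
  inner : ∀ a p → ballot (suc (a +ℕ suc p)) (suc a) +ℕ ((a +ℕ suc p +ℕ suc p) C suc (a +ℕ suc p)) ≡ (a +ℕ suc p +ℕ suc p) C (a +ℕ suc p) →
    ballot (suc (suc (suc a) +ℕ p)) (suc (suc (suc a))) +ℕ ((suc (suc a) +ℕ p +ℕ p) C suc (suc (suc a) +ℕ p)) ≡ (suc (suc a) +ℕ p +ℕ p) C (suc (suc a) +ℕ p) →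
    ballot (suc (suc a +ℕ suc p)) (suc (suc a)) +ℕ ((suc a +ℕ suc p +ℕ suc p) C suc (suc a +ℕ suc p)) ≡ (suc a +ℕ suc p +ℕ suc p) C (suc a +ℕ suc p)
  inner a p ih1 ih2 rewrite ℕP.+-suc a p | ℕP.+-suc (a +ℕ p) p =
    trans (cong₂ _+ℕ_ (ballot-rec (suc (suc (a +ℕ p))) (suc a)) (sym (nCk+nC[k+1]≡[n+1]C[k+1] (suc (suc (a +ℕ p +ℕ p))) (suc (suc (a +ℕ p))))))
    (trans (combine _ _ _ _ _ ih1 ih2) (nCk+nC[k+1]≡[n+1]C[k+1] (suc (suc (a +ℕ p +ℕ p))) (suc (a +ℕ p))))

absorption : ∀ n k → suc k *ℕ (suc n C suc k) ≡ suc n *ℕ (n C k)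
absorption zero    zero    = refl
absorption zero    (suc k) rewrite k>n⇒nCk≡0 {1} {suc (suc k)} (s≤s (s≤s z≤n)) | k>n⇒nCk≡0 {0} {suc k} (s≤s z≤n) = ℕP.*-zeroʳ (suc (suc k))
absorption (suc n) zero    rewrite nC1≡n (suc (suc n)) = trans (ℕP.*-identityˡ (suc (suc n))) (sym (ℕP.*-identityʳ (suc (suc n))))
absorption (suc n) (suc k) =
  trans (cong (suc (suc k) *ℕ_) (sym (nCk+nC[k+1]≡[n+1]C[k+1] (suc n) (suc k))))
  (trans (expand (suc n C suc k) (suc n C suc (suc k)) k)
  (trans (cong₂ (λ p q → p +ℕ suc n C suc k +ℕ q) (absorption n k) (absorption n (suc k)))
  (trans (factor (suc n) (n C k) (n C suc k) (suc n C suc k))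
  (trans (cong (λ v → suc n *ℕ v +ℕ suc n C suc k) (nCk+nC[k+1]≡[n+1]C[k+1] n k)) (collect n (suc n C suc k))))))
  where
  expand : ∀ X Y k → suc (suc k) *ℕ (X +ℕ Y) ≡ suc k *ℕ X +ℕ X +ℕ suc (suc k) *ℕ Y
  expand = ℕ-Solver.solve-∀
  factor : ∀ n A B X → n *ℕ A +ℕ X +ℕ n *ℕ B ≡ n *ℕ (A +ℕ B) +ℕ X
  factor = ℕ-Solver.solve-∀
  collect : ∀ n X → suc n *ℕ X +ℕ X ≡ suc (suc n) *ℕ X
  collect = ℕ-Solver.solve-∀

ballot-times : ∀ M → ballot (suc M) 1 *ℕ suc M ≡ (M +ℕ M) C M
ballot-times zero    = refl
ballot-times (suc M) = go (suc M +ℕ suc M) refl (ballot-binomial (suc M) 0)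
  where
  n = M +ℕ suc M
  -- (M+2) C(n+1, M+2) = (M+1) C(n+1, M+1) by absorption and symmetry.
  shifted : suc (suc M) *ℕ (suc n C suc (suc M)) ≡ suc M *ℕ (suc n C suc M)
  shifted = trans (absorption n (suc M))
    (trans (cong (suc n *ℕ_) (sym (trans (nCk≡nC[n∸k] (ℕP.m≤m+n M (suc M))) (cong (n C_) (ℕP.m+n∸m≡n M (suc M))))))
           (sym (absorption n M)))
  go : ∀ N → N ≡ suc n → ballot (suc (suc M)) 1 +ℕ (N C suc (suc M)) ≡ N C suc M →
       ballot (suc (suc M)) 1 *ℕ suc (suc M) ≡ N C suc M
  go N refl e = ℕP.+-cancelʳ-≡ (suc (suc M) *ℕ X) _ _
      (trans (distribute b X (suc M)) (trans (cong (suc (suc M) *ℕ_) e) (trans (split (suc M) Cc) (cong (Cc +ℕ_) (sym shifted)))))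
    where
    b = ballot (suc (suc M)) 1
    X = suc n C suc (suc M)
    Cc = suc n C suc M
    distribute : ∀ b X m → b *ℕ suc m +ℕ suc m *ℕ X ≡ suc m *ℕ (b +ℕ X)
    distribute = ℕ-Solver.solve-∀
    split : ∀ m C → suc m *ℕ C ≡ C +ℕ m *ℕ C
    split = ℕ-Solver.solve-∀

ballot≡catalan : ∀ M → ballot (suc M) 1 ≡ catalan M
ballot≡catalan M = sym (trans (cong (λ v → (v C M) / suc M) double)
  (trans (cong (_/ suc M) (sym (ballot-times M))) (m*n/n≡m (ballot (suc M) 1) (suc M))))
  where
  double : 2 *ℕ M ≡ M +ℕ M
  double = cong (M +ℕ_) (ℕP.+-identityʳ M)

-- The same column read one row down, via the ballot recursion with ballot (M+1) 0 = 0.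
ballot≡catalan₂ : ∀ M → ballot (suc (suc M)) 2 ≡ catalan (suc M)
ballot≡catalan₂ M = trans (sym (ballot-rec (suc M) 0)) (ballot≡catalan (suc M))

shiftBy : ℕ → (ℕ → ℤ) → ℕ → ℤ
shiftBy zero    w = w
shiftBy (suc k) w = sh (shiftBy k w)

shiftBy-value : ∀ k w j → shiftBy k w j ≡ w (j +ℕ k)
shiftBy-value zero    w j = cong w (sym (ℕP.+-identityʳ j))
shiftBy-value (suc k) w j = trans (shiftBy-value k w (suc j)) (cong w (sym (ℕP.+-suc j k)))

shiftBy-sh : ∀ k w j → shiftBy k (sh w) j ≡ shiftBy (suc k) w j
shiftBy-sh k w j = trans (shiftBy-value k (sh w) j) (trans (cong w (sym (ℕP.+-suc j k))) (sym (shiftBy-value (suc k) w j)))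

u : (ℕ → ℤ) → ℕ → ℤ
u y j = y j - + 1

u-one : ∀ y m → y m ≡ + 1 → u y m ≡ + 0
u-one y m h = cong (_- + 1) h

ballotCoeff : ℕ → ℕ → ℕ → ℤ
ballotCoeff M a j = + ballot (M ∸ j) a

ballotPoly : ℕ → ℕ → ℕ → (ℕ → ℤ) → ℤ
ballotPoly M a L w = sparsePoly (ballotCoeff M a) L w

-- The closed forms of Φ m t y for t = δ_a and for t = y on positions ≥ k (see below).
firstDescentPoly : ℕ → ℕ → (ℕ → ℤ) → ℤ
firstDescentPoly m a y = ballotPoly m a (m ∸ suc (suc a)) (shiftBy (suc a) (u y))

tailPoly : ℕ → ℕ → (ℕ → ℤ) → ℤ
tailPoly m k y = ballotPoly (suc m) (suc k) (m ∸ suc k) (shiftBy k (u y)) + u y k * firstDescentPoly m k y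

ballotPoly-rec : ∀ m a L w → L ≤ℕ m → ballotPoly (suc m) (suc a) L w ≡ ballotPoly m a L w + ballotPoly (suc m) (suc (suc a)) L w
ballotPoly-rec m a L w Lm =
  trans (sparsePoly-congᶜ L w (λ j le → coeff j (ℕP.≤-trans le Lm))) (sparsePoly-+ (ballotCoeff m a) (ballotCoeff (suc m) (suc (suc a))) L w)
  where
  coeff : ∀ j → j ≤ℕ m → ballotCoeff (suc m) (suc a) j ≡ ballotCoeff m a j + ballotCoeff (suc m) (suc (suc a)) j
  coeff j le rewrite ℕP.+-∸-assoc 1 le = trans (cong +_ (ballot-rec (m ∸ j) a)) (ℤP.pos-+ (ballot (m ∸ j) a) _)

vanishing-term : ∀ (y : ℕ → ℤ) m k → m ≤ℕ k → y m ≡ + 1 → u y k * + ballot m k ≡ + 0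
vanishing-term y m k le h with ℕP.m≤n⇒m<n∨m≡n le
... | inj₁ lt   rewrite ballot-vanish m k lt = ℤP.*-zeroʳ (u y k)
... | inj₂ refl rewrite u-one y m h = refl

pred-∸ : ∀ m n → pred (pred (m ∸ n)) ≡ m ∸ suc (suc n)
pred-∸ m n = trans (cong pred (ℕP.pred[m∸n]≡m∸[1+n] m n)) (ℕP.pred[m∸n]≡m∸[1+n] m (suc n))

ballotPoly-peel : ∀ m k W D → m ∸ suc k ≡ D → (m ≤ℕ suc k → W 1 * + ballot m (suc k) ≡ + 0) →
  ballotPoly (suc m) (suc k) D W
    ≡ ballotPoly m k (pred D) (sh W) + ballotPoly (suc m) (suc (suc k)) (pred D) (sh W)
      + W 1 * ballotPoly m (suc k) (pred (pred D)) (sh (sh W))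
ballotPoly-peel m k W zero e vanish =
  trans (cong +_ (ballot-rec m k))
  (trans (ℤP.pos-+ (ballot m k) _)
  (trans (sym (ℤP.+-identityʳ _)) (cong (_+_ (+ ballot m k + + ballot (suc m) (suc (suc k)))) (sym (vanish (ℕP.m∸n≡0⇒m≤n e))))))
ballotPoly-peel m k W (suc L) e vanish =
  trans (sparsePoly-suc (ballotCoeff (suc m) (suc k)) L W)
        (cong (_+ W 1 * ballotPoly m (suc k) (pred L) (sh (sh W))) (ballotPoly-rec m k L (sh W) L≤m))
  where
  L≤m : L ≤ℕ m
  L≤m = ℕP.≤-trans (ℕP.n≤1+n L) (subst (_≤ℕ m) e (ℕP.m∸n≤m m (suc k)))

ballotPoly-split : ∀ m b W D → m ∸ suc (suc b) ≡ D → (m ≤ℕ suc (suc b) → W 1 * + ballot m (suc (suc b)) ≡ + 0) →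
  ballotPoly (suc m) (suc b) D W
    ≡ ballotPoly m b D W + ballotPoly m (suc b) (pred D) (sh W)
      + (ballotPoly (suc m) (suc (suc (suc b))) (pred D) (sh W) + W 1 * ballotPoly m (suc (suc b)) (pred (pred D)) (sh (sh W)))
ballotPoly-split m b W zero e vanish =
  trans (cong +_ (trans (ballot-rec m b) (cong (ballot m b +ℕ_) (ballot-rec m (suc b)))))
  (trans (trans (ℤP.pos-+ (ballot m b) _) (cong (_+_ (+ ballot m b)) (ℤP.pos-+ (ballot m (suc b)) _)))
  (trans (regroup (+ ballot m b) (+ ballot m (suc b)) (+ ballot (suc m) (suc (suc (suc b)))))
         (cong (λ v → + ballot m b + + ballot m (suc b) + (+ ballot (suc m) (suc (suc (suc b))) + v))
               (sym (vanish (ℕP.m∸n≡0⇒m≤n e))))))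
  where
  regroup : ∀ (a b c : ℤ) → a + (b + c) ≡ a + b + (c + + 0)
  regroup = solve-∀
ballotPoly-split (suc m) b W (suc L) e vanish = begin
    ballotPoly (suc (suc m)) (suc b) (suc L) W
  ≡⟨ sparsePoly-suc (ballotCoeff (suc (suc m)) (suc b)) L W ⟩
    Q (suc (suc m)) (suc b) L (sh W) + W 1 * Q (suc m) (suc b) (pred L) (sh (sh W))
  ≡⟨ cong₂ (λ p q → p + W 1 * q)
       (trans (ballotPoly-rec (suc m) b L (sh W) L≤1+m) (cong (_+_ (Q (suc m) b L (sh W))) (ballotPoly-rec (suc m) (suc b) L (sh W) L≤1+m)))
       (ballotPoly-rec m b (pred L) (sh (sh W)) (ℕP.≤-trans ℕP.pred[n]≤n L≤m)) ⟩
    Q (suc m) b L (sh W) + (Q (suc m) (suc b) L (sh W) + Q (suc (suc m)) (suc (suc (suc b))) L (sh W))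
      + W 1 * (Q m b (pred L) (sh (sh W)) + Q (suc m) (suc (suc b)) (pred L) (sh (sh W)))
  ≡⟨ regroup (Q (suc m) b L (sh W)) (Q (suc m) (suc b) L (sh W)) (Q (suc (suc m)) (suc (suc (suc b))) L (sh W))
               (Q m b (pred L) (sh (sh W))) (Q (suc m) (suc (suc b)) (pred L) (sh (sh W))) (W 1) ⟩
    (Q (suc m) b L (sh W) + W 1 * Q m b (pred L) (sh (sh W))) + Q (suc m) (suc b) L (sh W)
      + (Q (suc (suc m)) (suc (suc (suc b))) L (sh W) + W 1 * Q (suc m) (suc (suc b)) (pred L) (sh (sh W)))
  ≡⟨ cong (λ v → v + Q (suc m) (suc b) L (sh W) + (Q (suc (suc m)) (suc (suc (suc b))) L (sh W) + W 1 * Q (suc m) (suc (suc b)) (pred L) (sh (sh W))))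
         (sym (sparsePoly-suc (ballotCoeff (suc m) b) L W)) ⟩
    Q (suc m) b (suc L) W + Q (suc m) (suc b) L (sh W)
      + (Q (suc (suc m)) (suc (suc (suc b))) L (sh W) + W 1 * Q (suc m) (suc (suc b)) (pred L) (sh (sh W)))
  ∎
  where
  open ≡-Reasoning
  Q = ballotPoly
  L≤m : L ≤ℕ m
  L≤m = ℕP.≤-pred (subst (_≤ℕ suc m) e (ℕP.m∸n≤m (suc m) (suc (suc b))))
  L≤1+m : L ≤ℕ suc m
  L≤1+m = ℕP.≤-trans L≤m (ℕP.n≤1+n m)
  regroup : ∀ (a1 a2 a3 c1 c2 w : ℤ) → a1 + (a2 + a3) + w * (c1 + c2) ≡ (a1 + w * c1) + a2 + (a3 + w * c2)
  regroup = solve-∀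

-- A nonempty word has no descent at position 0.
firstDescentPoly-zero : ∀ m z → firstDescentPoly (suc m) 0 z ≡ + 0
firstDescentPoly-zero m z =
  trans (sparsePoly-congᶜ (m ∸ 1) _ (λ j le → coeff j (ℕP.≤-trans le (ℕP.m∸n≤m m 1)))) (sparsePoly-zero (m ∸ 1) _)
  where
  coeff : ∀ j → j ≤ℕ m → ballotCoeff (suc m) 0 j ≡ + 0
  coeff j le rewrite ℕP.+-∸-assoc 1 le = refl

tailPoly-vanish : ∀ m k y → m <ℕ k → tailPoly m k y ≡ + 0
tailPoly-vanish m k y lt
  rewrite ℕP.m≤n⇒m∸n≡0 (ℕP.≤-trans (ℕP.<⇒≤ lt) (ℕP.n≤1+n k))
        | ℕP.m≤n⇒m∸n≡0 (ℕP.≤-trans (ℕP.<⇒≤ lt) (ℕP.≤-trans (ℕP.n≤1+n k) (ℕP.n≤1+n (suc k))))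
        | ballot-vanish (suc m) (suc k) (s≤s lt) | ballot-vanish m k lt
  = trans (ℤP.+-identityˡ _) (ℤP.*-zeroʳ (u y k))

-- The tail closed form splits off its first position k (as t = y k δ_k + tail at k+1).
tailPoly-step : ∀ m k y → y m ≡ + 1 → tailPoly m k y ≡ y k * firstDescentPoly m k y + tailPoly m (suc k) y
tailPoly-step m k y hy =
  trans (cong (_+ u y k * P0) peeled) (regroup (y k) P0 Q2 (u y (suc k)) P1)
  where
  W = shiftBy k (u y)
  P0 = firstDescentPoly m k y
  P1 = firstDescentPoly m (suc k) y
  Q2 = ballotPoly (suc m) (suc (suc k)) (m ∸ suc (suc k)) (sh W)
  vanish : m ≤ℕ suc k → W 1 * + ballot m (suc k) ≡ + 0
  vanish le = trans (cong (_* + ballot m (suc k)) (shiftBy-value k (u y) 1)) (vanishing-term y m (suc k) le hy)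
  peeled : ballotPoly (suc m) (suc k) (m ∸ suc k) W ≡ P0 + Q2 + u y (suc k) * P1
  peeled = trans (ballotPoly-peel m k W (m ∸ suc k) refl vanish)
    (trans (cong₂ (λ L1 L2 → ballotPoly m k L1 (sh W) + ballotPoly (suc m) (suc (suc k)) L1 (sh W) + W 1 * ballotPoly m (suc k) L2 (sh (sh W)))
                  (ℕP.pred[m∸n]≡m∸[1+n] m (suc k)) (pred-∸ m (suc k)))
           (cong (λ v → P0 + Q2 + v * P1) (shiftBy-value k (u y) 1)))
  regroup : ∀ (yk p q2 u1 p1 : ℤ) → (p + q2 + u1 * p1) + (yk - + 1) * p ≡ yk * p + (q2 + u1 * p1)
  regroup = solve-∀

firstDescentPoly-sh : ∀ m a z → firstDescentPoly m a (sh z) ≡ ballotPoly m a (m ∸ suc (suc a)) (shiftBy (suc (suc a)) (u z))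
firstDescentPoly-sh m a z = sparsePoly-congʷ (ballotCoeff m a) (m ∸ suc (suc a)) (λ j _ → shiftBy-sh (suc a) (u z) (suc j))

tailPoly-sh : ∀ m k z → tailPoly m k (sh z)
  ≡ ballotPoly (suc m) (suc k) (m ∸ suc k) (shiftBy (suc k) (u z)) + u z (suc k) * ballotPoly m k (m ∸ suc (suc k)) (shiftBy (suc (suc k)) (u z))
tailPoly-sh m k z = cong₂ (λ p q → p + u z (suc k) * q)
  (sparsePoly-congʷ (ballotCoeff (suc m) (suc k)) (m ∸ suc k) (λ j _ → shiftBy-sh k (u z) (suc j))) (firstDescentPoly-sh m k z)

-- The closed forms satisfy the recursion that Φ-insertion imposes on δ_{b+1}.
firstDescentPoly-step : ∀ m b z → z (suc m) ≡ + 1 →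
  firstDescentPoly (suc m) (suc b) z ≡ firstDescentPoly m b (sh z) + firstDescentPoly m (suc b) (sh z) + tailPoly m (suc (suc b)) (sh z)
firstDescentPoly-step m b z hz = sym (trans
  (cong₂ _+_ (cong₂ _+_ (firstDescentPoly-sh m b z) (firstDescentPoly-sh m (suc b) z)) (tailPoly-sh m (suc (suc b)) z))
  (sym (trans (ballotPoly-split m b W (m ∸ suc (suc b)) refl vanish)
    (cong₃ (ℕP.pred[m∸n]≡m∸[1+n] m (suc (suc b))) (pred-∸ m (suc (suc b))) (shiftBy-value (suc (suc b)) (u z) 1)))))
  where
  W = shiftBy (suc (suc b)) (u z)
  vanish : m ≤ℕ suc (suc b) → W 1 * + ballot m (suc (suc b)) ≡ + 0
  vanish le = trans (cong (_* + ballot m (suc (suc b))) (shiftBy-value (suc (suc b)) (u z) 1)) (vanishing-term (sh z) m (suc (suc b)) le hz)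
  cong₃ : ∀ {L1 L1' L2 L2' v v'} → L1 ≡ L1' → L2 ≡ L2' → v ≡ v' →
    ballotPoly m b (m ∸ suc (suc b)) W + ballotPoly m (suc b) L1 (sh W)
      + (ballotPoly (suc m) (suc (suc (suc b))) L1 (sh W) + v * ballotPoly m (suc (suc b)) L2 (sh (sh W)))
    ≡ ballotPoly m b (m ∸ suc (suc b)) W + ballotPoly m (suc b) L1' (sh W)
      + (ballotPoly (suc m) (suc (suc (suc b))) L1' (sh W) + v' * ballotPoly m (suc (suc b)) L2' (sh (sh W)))
  cong₃ refl refl refl = refl

indicator : ℕ → ℕ → ℤ
indicator b a = if a ≡ᵇ b then + 1 else + 0

tailWeight : ℕ → (ℕ → ℤ) → ℕ → ℤ
tailWeight k y a = if a <ᵇ k then + 0 else y a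

firstDescentPoly-empty : ∀ a y → firstDescentPoly 0 a y ≡ indicator a 0
firstDescentPoly-empty zero    y = refl
firstDescentPoly-empty (suc a) y = refl

partialSum-vanish : ∀ a t → (∀ j → j <ℕ a → t (suc j) ≡ + 0) → partialSum t a ≡ + 0
partialSum-vanish zero    t h = refl
partialSum-vanish (suc a) t h = cong₂ _+_ (h 0 (s≤s z≤n)) (partialSum-vanish a (sh t) (λ j lt → h (suc j) (s≤s lt)))

-- Φ m t y only depends on t at positions 0 … m (first descents of words of length m).
Φ-vanish : ∀ m t y → y m ≡ + 1 → (∀ a → a ≤ℕ m → t a ≡ + 0) → Φ m t y ≡ + 0
Φ-vanish zero    t y hy ht = trans (Φ-empty t y) (ht 0 z≤n)
Φ-vanish (suc m) t y hy ht = trans (Φ-insertion m t y hy) (Φ-vanish m (insertHead t (sh y)) (sh y) hy ht')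
  where
  zeros : ∀ (y : ℤ) → + 0 + + 0 + y * + 0 ≡ + 0
  zeros = solve-∀
  ht' : ∀ a → a ≤ℕ m → insertHead t (sh y) a ≡ + 0
  ht' zero    _  = ht 1 (s≤s z≤n)
  ht' (suc a) le = trans
    (cong₂ _+_ (cong₂ _+_ (ht (suc (suc a)) (s≤s le)) (ht (suc a) (ℕP.≤-trans le (ℕP.n≤1+n m))))
               (cong (sh y (suc a) *_) (partialSum-vanish a t
                 (λ j lt → ht (suc j) (ℕP.≤-trans lt (ℕP.≤-trans (ℕP.n≤1+n a) (ℕP.≤-trans le (ℕP.n≤1+n m))))))))
    (zeros (sh y (suc a)))

tailWeight-split : ∀ k y a → tailWeight k y a ≡ y k * indicator k a + tailWeight (suc k) y a
tailWeight-split zero    y zero    = unit (y 0)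
  where
  unit : ∀ (y : ℤ) → y ≡ y * + 1 + + 0
  unit = solve-∀
tailWeight-split zero    y (suc a) = absorb (y 0) (y (suc a))
  where
  absorb : ∀ (y z : ℤ) → z ≡ y * + 0 + z
  absorb = solve-∀
tailWeight-split (suc k) y zero    = sym (trans (ℤP.+-identityʳ _) (ℤP.*-zeroʳ (y (suc k))))
tailWeight-split (suc k) y (suc a) = tailWeight-split k (sh y) a

tailWeight-below : ∀ k y a → a <ℕ k → tailWeight k y a ≡ + 0
tailWeight-below k y a lt = cong (λ v → if v then + 0 else y a) (<ᵇ-true a k lt)
  where
  <ᵇ-true : ∀ a k → a <ℕ k → (a <ᵇ k) ≡ true
  <ᵇ-true zero    (suc k) _        = refl
  <ᵇ-true (suc a) (suc k) (s≤s lt) = <ᵇ-true a k lt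

partialSum-indicator : ∀ b a → partialSum (indicator (suc b)) a ≡ (if a <ᵇ suc b then + 0 else + 1)
partialSum-indicator b       zero    = refl
partialSum-indicator zero    (suc a) = cong (_+_ (+ 1)) (partialSum-vanish a (indicator 0) (λ j _ → refl))
partialSum-indicator (suc b) (suc a) = trans (ℤP.+-identityˡ _) (partialSum-indicator b a)

insertHead-indicator₀ : ∀ y a → insertHead (indicator 0) y a ≡ + 0
insertHead-indicator₀ y zero    = refl
insertHead-indicator₀ y (suc a) =
  trans (cong (λ v → + 0 + + 0 + y (suc a) * v) (partialSum-vanish a (indicator 0) (λ j _ → refl))) (zeros (y (suc a)))
  where
  zeros : ∀ (y : ℤ) → + 0 + + 0 + y * + 0 ≡ + 0
  zeros = solve-∀

insertHead-indicator : ∀ b y a → insertHead (indicator (suc b)) y a ≡ indicator b a + indicator (suc b) a + tailWeight (suc (suc b)) y a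
insertHead-indicator b y zero    = sym (trans (ℤP.+-identityʳ _) (ℤP.+-identityʳ _))
insertHead-indicator b y (suc a) =
  cong (_+_ (indicator b (suc a) + indicator (suc b) (suc a)))
       (trans (cong (y (suc a) *_) (partialSum-indicator b a)) (mask (a <ᵇ suc b) (y (suc a))))
  where
  mask : ∀ c (v : ℤ) → v * (if c then + 0 else + 1) ≡ (if c then + 0 else v)
  mask true  v = ℤP.*-zeroʳ v
  mask false v = ℤP.*-identityʳ v

-- Closed forms of Φ on tail weights, given the closed forms on all indicators:
-- split off δ_k and recurse on k until k exceeds m.
Φ-tail : ∀ m y → y m ≡ + 1 → (∀ a → Φ m (indicator a) y ≡ firstDescentPoly m a y) →
  ∀ d k → suc m ≤ℕ k +ℕ d → Φ m (tailWeight k y) y ≡ tailPoly m k y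
Φ-tail m y hy closed zero k le =
  trans (Φ-vanish m (tailWeight k y) y hy (λ a a≤m → tailWeight-below k y a (ℕP.≤-trans (s≤s a≤m) m<k)))
        (sym (tailPoly-vanish m k y m<k))
  where
  m<k : suc m ≤ℕ k
  m<k = subst (suc m ≤ℕ_) (ℕP.+-identityʳ k) le
Φ-tail m y hy closed (suc d) k le =
  trans (Φ-cong m y (tailWeight-split k y))
  (trans (Φ-+ m (λ a → y k * indicator k a) (tailWeight (suc k) y) y)
  (trans (cong₂ _+_ (trans (Φ-scale m (y k) (indicator k) y) (cong (y k *_) (closed k)))
                    (Φ-tail m y hy closed d (suc k) (subst (suc m ≤ℕ_) (ℕP.+-suc k d) le)))
         (sym (tailPoly-step m k y hy))))

Φ-indicator : ∀ m a y → y m ≡ + 1 → Φ m (indicator a) y ≡ firstDescentPoly m a y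
Φ-indicator zero    a y hy = trans (Φ-empty (indicator a) y) (sym (firstDescentPoly-empty a y))
Φ-indicator (suc m) zero z hz =
  trans (Φ-insertion m (indicator 0) z hz)
  (trans (Φ-cong m (sh z) (insertHead-indicator₀ (sh z)))
  (trans (Φ-zero m (sh z)) (sym (firstDescentPoly-zero m z))))
Φ-indicator (suc m) (suc b) z hz =
  trans (Φ-insertion m (indicator (suc b)) z hz)
  (trans (Φ-cong m y (insertHead-indicator b y))
  (trans (Φ-+ m (λ a → indicator b a + indicator (suc b) a) (tailWeight (suc (suc b)) y) y)
  (trans (cong₂ _+_ (trans (Φ-+ m (indicator b) (indicator (suc b)) y)
                           (cong₂ _+_ (Φ-indicator m b y hz) (Φ-indicator m (suc b) y hz)))
                    (Φ-tail m y hz (λ a → Φ-indicator m a y hz) m (suc (suc b)) le))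
         (sym (firstDescentPoly-step m b z hz)))))
  where
  y = sh z
  le : suc m ≤ℕ suc (suc b) +ℕ m
  le = ℕP.≤-trans (s≤s (ℕP.m≤n+m m b)) (ℕP.n≤1+n _)

-- x with the variable at the (never descending) last position n set to 1.
capAt : ℕ → (ℕ → ℤ) → ℕ → ℤ
capAt n x a = if a ≡ᵇ n then + 1 else x a

capAt-top : ∀ n x → capAt n x n ≡ + 1
capAt-top n x = cong (λ v → if v then + 1 else x n) (≡ᵇ-refl n)
  where
  ≡ᵇ-refl : ∀ n → (n ≡ᵇ n) ≡ true
  ≡ᵇ-refl zero    = refl
  ≡ᵇ-refl (suc n) = ≡ᵇ-refl n

capAt-below : ∀ n x a → a <ℕ n → capAt n x a ≡ x a
capAt-below n x a lt = cong (λ v → if v then + 1 else x a) (≡ᵇ-false a n lt)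
  where
  ≡ᵇ-false : ∀ a n → a <ℕ n → (a ≡ᵇ n) ≡ false
  ≡ᵇ-false zero    (suc n) _        = refl
  ≡ᵇ-false (suc a) (suc n) (s≤s lt) = ≡ᵇ-false a n lt

lhs≡Φ : ∀ n x → lhs (suc n) x ≡ Φ (suc n) (tailWeight 1 (capAt (suc n) x)) (capAt (suc n) x)
lhs≡Φ n x = sum-congᴬ (All.map (λ {π} → pointwise π) lengths)
  where
  y = capAt (suc n) x
  lengths : All (λ π → length π ≡ suc n) (Sn321 (suc n))
  lengths = AllP.filter⁺ (λ π → T? (not (contains321 π)))
    (All.map (λ e → trans e (trans (length-map suc (upTo (suc n))) (length-upTo (suc n)))) (length-perms (range1 (suc n))))
  pointwise : ∀ π → length π ≡ suc n → xDes x π ≡ weight (tailWeight 1 y) y π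
  pointwise (p ∷ π) e =
    trans (xDes-local x y (p ∷ π) (λ a le → sym (capAt-below (suc n) x (suc a) (subst (suc (suc a) ≤ℕ_) e le))))
          (xDes≡weight p (tailWeight 1 y) y π (λ _ → refl) (trans (cong y e) (capAt-top (suc n) x)))

Φ≡tailPoly : ∀ n y → y n ≡ + 1 → Φ n (tailWeight 1 y) y ≡ tailPoly n 1 y
Φ≡tailPoly n y hy = Φ-tail n y hy (λ a → Φ-indicator n a y hy) n 1 ℕP.≤-refl

-- Matching coefficients (ballot = Catalan) and variables (capAt n x = x below n).
tailPoly≡rhs : ∀ n x → tailPoly (suc (suc n)) 1 (capAt (suc (suc n)) x) ≡ rhs (suc (suc n)) x
tailPoly≡rhs n x = begin
    ballotPoly (suc N) 2 n (sh U') + U 1 * ballotPoly N 1 (n ∸ 1) (sh (sh U'))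
  ≡⟨ cong₂ (λ p q → p + U 1 * q) outer inner ⟩
    sparsePoly c n (sh U) + U 1 * sparsePoly (c ∘ suc) (pred n) (sh (sh U))
  ≡⟨ sym (sparsePoly-suc c n U) ⟩
    sparsePoly c (suc n) U
  ≡⟨ sym (rhs≡sparsePoly N x) ⟩
    rhs N x
  ∎
  where
  N = suc (suc n)
  U = u x
  U' = u (capAt N x)
  c = λ k → + catalan (N ∸ k)
  open ≡-Reasoning
  pred≡∸1 : ∀ n → n ∸ 1 ≡ pred n
  pred≡∸1 zero    = refl
  pred≡∸1 (suc n) = refl
  coeff₁ : ∀ j → j ≤ℕ n → ballotCoeff (suc N) 2 j ≡ c j
  coeff₁ j le rewrite ℕP.+-∸-assoc 3 le | ℕP.+-∸-assoc 2 le = cong +_ (ballot≡catalan₂ (suc (n ∸ j)))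
  coeff₂ : ∀ j → j ≤ℕ n ∸ 1 → ballotCoeff N 1 j ≡ c (suc j)
  coeff₂ j le = below n j (ℕP.≤-trans le (ℕP.m∸n≤m n 1))
    where
    below : ∀ n j → j ≤ℕ n → ballotCoeff (suc (suc n)) 1 j ≡ + catalan (suc (suc n) ∸ suc j)
    below n j j≤n rewrite ℕP.+-∸-assoc 2 j≤n | ℕP.+-∸-assoc 1 j≤n = cong +_ (ballot≡catalan (suc (n ∸ j)))
  var₁ : ∀ j → j <ℕ n → sh U' (suc j) ≡ sh U (suc j)
  var₁ j lt = cong (_- + 1) (capAt-below N x (suc (suc j)) (s≤s (s≤s lt)))
  var₂ : ∀ j → j <ℕ n ∸ 1 → sh (sh U') (suc j) ≡ sh (sh U) (suc j)
  var₂ j lt = cong (_- + 1) (capAt-below N x (suc (suc (suc j))) (s≤s (s≤s (unpred n lt))))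
    where
    unpred : ∀ n → j <ℕ n ∸ 1 → suc j <ℕ n
    unpred (suc n) lt = s≤s lt
  outer : ballotPoly (suc N) 2 n (sh U') ≡ sparsePoly c n (sh U)
  outer = trans (sparsePoly-congᶜ n (sh U') coeff₁) (sparsePoly-congʷ c n var₁)
  inner : ballotPoly N 1 (n ∸ 1) (sh (sh U')) ≡ sparsePoly (c ∘ suc) (pred n) (sh (sh U))
  inner = trans (sparsePoly-congᶜ (n ∸ 1) (sh (sh U')) coeff₂)
    (trans (sparsePoly-congʷ (c ∘ suc) (n ∸ 1) var₂) (cong (λ L → sparsePoly (c ∘ suc) L (sh (sh U))) (pred≡∸1 n)))

corollary5p2 : (n : ℕ) (x : ℕ → ℤ) → lhs n x ≡ rhs n x
corollary5p2 zero          x = refl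
corollary5p2 (suc zero)    x = refl
corollary5p2 (suc (suc n)) x = begin
    lhs N x
  ≡⟨ lhs≡Φ (suc n) x ⟩
    Φ N (tailWeight 1 y) y
  ≡⟨ Φ≡tailPoly N y (capAt-top N x) ⟩
    tailPoly N 1 y
  ≡⟨ tailPoly≡rhs n x ⟩
    rhs N x
  ∎
  where
  open ≡-Reasoning
  N = suc (suc n)
  y = capAt N x
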